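{- Let $G$ be a finite undirected graph and let $P$ and $Q$ be two shortest paths in $G$ that have at least one vertex in common. Then $P$ and $Q$ are either parallel or antiparallel.
   Context: A shortest path is a vertex sequence $v_0,\dots,v_n$ with consecutive vertices adjacent and $d(v_0,v_n)=n$, where $d$ is graph distance. Let $P\cap Q=\{a_0,\dots,a_n\}$ be the set of common vertices, listed in the order they appear in $P$. The paths are parallel if these common vertices appear in the same order $a_0,\dots,a_n$ in $Q$. They are antiparallel if $n\ge 1$ and these vertices appear in $Q$ in the reverse order $a_n,\dots,a_0$. -}

module Defs where

open import Data.Nat using (ℕ; zero; suc; _≤_; _<_; _≥_)
open import Data.Fin using (Fin; toℕ; fromℕ; inject₁) renaming (zero to fzero; suc to fsuc)
open import Data.Product using (Σ; ∃; _×_; _,_)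
open import Data.Sum using (_⊎_)
open import Relation.Binary.PropositionalEquality using (_≡_)

record Graph : Set₁ where
  field
    N    : ℕ
    Adj  : Fin N → Fin N → Set
    sym  : ∀ {u v} → Adj u v → Adj v u

module _ (G : Graph) where
  open Graph G

  Vertex : Set
  Vertex = Fin N

  data Walk : Vertex → Vertex → ℕ → Set where
    here : ∀ {u} → Walk u u zero
    step : ∀ {u v w n} → Adj u v → Walk v w n → Walk u w (suc n)

  Dist : Vertex → Vertex → ℕ → Set
  Dist u v n = Walk u v n × (∀ m → Walk u v m → n ≤ m)

  Path : ℕ → Set
  Path n = Fin (suc n) → Vertex

  IsShortestPath : (n : ℕ) → Path n → Set
  IsShortestPath n p =
    (∀ (i : Fin n) → Adj (p (inject₁ i)) (p (fsuc i))) × Dist (p fzero) (p (fromℕ n)) n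

  OnPath : ∀ {m} → Path m → Vertex → Set
  OnPath {m} q x = ∃ λ (k : Fin (suc m)) → q k ≡ x

  Intersect : ∀ {n m} → Path n → Path m → Set
  Intersect p q = ∃ λ i → OnPath q (p i)

  Parallel : ∀ {n m} → Path n → Path m → Set
  Parallel p q = ∀ i j k l → p i ≡ q k → p j ≡ q l → toℕ i < toℕ j → toℕ k < toℕ l

  Antiparallel : ∀ {n m} → Path n → Path m → Set
  Antiparallel p q =
    (∃ λ i → ∃ λ j → toℕ i < toℕ j × OnPath q (p i) × OnPath q (p j))
    × (∀ i j k l → p i ≡ q k → p j ≡ q l → toℕ i < toℕ j → toℕ l < toℕ k)

-- On a shortest path the vertices at positions i ≤ j are at distance j − i. So if
-- P i = Q k and P j = Q l, then |j − i| = |l − k|: every two common vertices are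
-- either aligned (l − k = j − i) or opposed (k − l = j − i). If some two common
-- vertices with i < j are opposed, then any further common vertex is opposed to one
-- of them (being aligned to both would align the two), so k + i is the same for all
-- common vertices and P, Q are antiparallel; otherwise all pairs are aligned.
module Submission where

open import Defs
open import Data.Nat using (ℕ; zero; suc; _+_; _∸_; _≤_; _<_; _<?_; s≤s)
open import Data.Nat.Properties
open import Data.Nat.Tactic.RingSolver using (solve-∀)
open import Data.Fin using (Fin; toℕ; fromℕ; fromℕ<; inject₁) renaming (zero to fzero; suc to fsuc)
open import Data.Fin.Properties using (toℕ-fromℕ<; toℕ≤pred[n]; any?) renaming (_≟_ to _≟ᶠ_)
open import Data.Product using (∃; _×_; _,_; proj₁; proj₂)
open import Data.Sum using (_⊎_; inj₁; inj₂)
import Data.Sum as Sum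
open import Relation.Nullary using (¬_; Dec; yes; no; contradiction)
open import Relation.Nullary.Decidable using (_×-dec_)
open import Relation.Binary.PropositionalEquality
open import Function using (_∘_)

offset : ∀ {a b} → a ≤ b → ∃ λ d → d + a ≡ b
offset {a} {b} a≤b = b ∸ a , m∸n+n≡m a≤b

-- For matches (i , k) and (j , l): l − k = j − i, resp. k − l = j − i, written without subtraction.
Aligned Opposed : ℕ → ℕ → ℕ → ℕ → Set
Aligned i k j l = k + j ≡ l + i
Opposed i k j l = k + i ≡ l + j

Aligned-< : ∀ {i k j l} → i < j → Aligned i k j l → k < l
Aligned-< {i} {k} i<j aligned = +-cancelʳ-< i k _ (subst (k + i <_) aligned (+-monoʳ-< k i<j))

Opposed-< : ∀ {i k j l} → i < j → Opposed i k j l → l < k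
Opposed-< {i} {k} {l = l} i<j opposed = +-cancelʳ-< i l k (subst (l + i <_) (sym opposed) (+-monoʳ-< l i<j))

Aligned-via : ∀ {a fa b fb c fc} → Aligned a fa c fc → Aligned b fb c fc → Aligned a fa b fb
Aligned-via {a} {fa} {b} {fb} {c} {fc} ac bc = +-cancelʳ-≡ (fc + c) (fa + b) (fb + a) (begin
  fa + b + (fc + c)   ≡⟨ regroup fa b fc c ⟩
  (fa + c) + (fc + b) ≡⟨ cong₂ _+_ ac (sym bc) ⟩
  (fc + a) + (fb + c) ≡⟨ +-comm (fc + a) (fb + c) ⟩
  (fb + c) + (fc + a) ≡⟨ sym (regroup fb a fc c) ⟩
  fb + a + (fc + c)   ∎)
  where
  open ≡-Reasoning
  regroup : ∀ w x y z → w + x + (y + z) ≡ (w + z) + (y + x)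
  regroup = solve-∀

Aligned-offset : ∀ {i j k l d e} → d ≡ e → d + i ≡ j → e + k ≡ l → Aligned i k j l
Aligned-offset {i} {k = k} {d = d} refl refl refl = trans (sym (+-assoc k d i)) (cong (_+ i) (+-comm k d))

Opposed-offset : ∀ {i j k l d e} → d ≡ e → d + i ≡ j → e + l ≡ k → Opposed i k j l
Opposed-offset {i} {l = l} {d} refl refl refl = trans (cong (_+ i) (+-comm d l)) (+-assoc l d i)

module _ (G : Graph) where
  open Graph G using (Adj) renaming (sym to Adj-sym)

  _++ʷ_ : ∀ {u v w a b} → Walk G u v a → Walk G v w b → Walk G u w (a + b)
  here     ++ʷ q = q
  step e p ++ʷ q = step e (p ++ʷ q)

  reverseʷ : ∀ {u v a} → Walk G u v a → Walk G v u a
  reverseʷ here = here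
  reverseʷ {a = suc a} (step e p) = subst (Walk G _ _) (+-comm a 1) (reverseʷ p ++ʷ step (Adj-sym e) here)

  Dist-sym : ∀ {u v d} → Dist G u v d → Dist G v u d
  Dist-sym (p , minimal) = reverseʷ p , λ m q → minimal m (reverseʷ q)

  Dist-unique : ∀ {u v d e} → Dist G u v d → Dist G u v e → d ≡ e
  Dist-unique (p , minimal-p) (q , minimal-q) = ≤-antisym (minimal-p _ q) (minimal-q _ p)

  middle-Dist : ∀ {u v w x a d r} → Walk G u v a → Walk G v w d → Walk G w x r →
    (∀ m → Walk G u x m → a + d + r ≤ m) → Dist G v w d
  middle-Dist {a = a} {d} {r} prefix q suffix minimal = q , λ m q′ →
    +-cancelˡ-≤ a d m (+-cancelʳ-≤ r (a + d) (a + m) (minimal _ ((prefix ++ʷ q′) ++ʷ suffix)))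

clamp : ℕ → (n : ℕ) → Fin (suc n)
clamp zero    n       = fzero
clamp (suc a) zero    = fzero
clamp (suc a) (suc n) = fsuc (clamp a n)

clamp-toℕ : ∀ {n} (i : Fin (suc n)) → clamp (toℕ i) n ≡ i
clamp-toℕ {n}     fzero    = refl
clamp-toℕ {suc n} (fsuc i) = cong fsuc (clamp-toℕ i)

clamp-inject₁ : ∀ {n} (i : Fin n) → clamp (toℕ i) n ≡ inject₁ i
clamp-inject₁ {suc n} fzero    = refl
clamp-inject₁ {suc n} (fsuc i) = cong fsuc (clamp-inject₁ i)

clamp-fromℕ : ∀ n → clamp n n ≡ fromℕ n
clamp-fromℕ zero    = refl
clamp-fromℕ (suc n) = cong fsuc (clamp-fromℕ n)

module ShortestPath (G : Graph) {n : ℕ} (P : Path G n) (sp : IsShortestPath G n P) where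
  open Graph G using (Adj)

  at : ℕ → Vertex G
  at a = P (clamp a n)

  at-toℕ : ∀ i → at (toℕ i) ≡ P i
  at-toℕ i = cong P (clamp-toℕ i)

  at-adjacent : ∀ a → a < n → Adj (at a) (at (suc a))
  at-adjacent a a<n = subst (λ b → Adj (at b) (at (suc b))) (toℕ-fromℕ< a<n) (adjacent (fromℕ< a<n))
    where
    adjacent : ∀ i → Adj (at (toℕ i)) (at (suc (toℕ i)))
    adjacent i = subst₂ Adj (cong P (sym (clamp-inject₁ i))) (sym (at-toℕ (fsuc i))) (proj₁ sp i)

  segment : ∀ {a b} d → d + a ≡ b → b ≤ n → Walk G (at a) (at b) d
  segment         zero    refl _   = here
  segment {a}     (suc d) refl b≤n =
    step (at-adjacent a (≤-trans (s≤s (m≤n+m a d)) b≤n)) (segment d (+-suc d a) b≤n)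

  segment-Dist : ∀ {a b} d → d + a ≡ b → b ≤ n → Dist G (at a) (at b) d
  segment-Dist {a} {b} d d+a≡b b≤n =
    middle-Dist G prefix (segment d d+a≡b b≤n) suffix minimal
    where
    r : ℕ
    r = n ∸ b
    prefix : Walk G (at 0) (at a) a
    prefix = segment a (+-identityʳ a) (≤-trans (≤-trans (m≤n+m a d) (≤-reflexive d+a≡b)) b≤n)
    suffix : Walk G (at b) (at n) r
    suffix = segment r (m∸n+n≡m b≤n) ≤-refl
    length : a + d + r ≡ n
    length = trans (cong (_+ r) (+-comm a d)) (trans (+-comm (d + a) r)
               (trans (cong (r +_) d+a≡b) (m∸n+n≡m b≤n)))
    minimal : ∀ m → Walk G (at 0) (at n) m → a + d + r ≤ m
    minimal m w = subst (_≤ m) (sym length)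
      (proj₂ (proj₂ sp) m (subst (λ v → Walk G (P fzero) v m) (cong P (clamp-fromℕ n)) w))

module _ (G : Graph) {n m : ℕ} (P : Path G n) (Q : Path G m) where

  Reversal : Set
  Reversal = ∃ λ i → ∃ λ j → ∃ λ k → ∃ λ l →
    P i ≡ Q k × P j ≡ Q l × toℕ i < toℕ j × toℕ l < toℕ k

  reversal? : Dec Reversal
  reversal? = any? λ i → any? λ j → any? λ k → any? λ l →
    P i ≟ᶠ Q k ×-dec P j ≟ᶠ Q l ×-dec toℕ i <? toℕ j ×-dec toℕ l <? toℕ k

  module _ (sp : IsShortestPath G n P) (sq : IsShortestPath G m Q) where
    module SP = ShortestPath G P sp
    module SQ = ShortestPath G Q sq

    aligned-or-opposed-≤ : ∀ {i j k l} → i ≤ j → j ≤ n → k ≤ m → l ≤ m →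
      SP.at i ≡ SQ.at k → SP.at j ≡ SQ.at l → Aligned i k j l ⊎ Opposed i k j l
    aligned-or-opposed-≤ {i} {j} {k} {l} i≤j j≤n k≤m l≤m Pi≡Qk Pj≡Ql = compare (≤-total k l)
      where
      lengths-agree : ∀ {d e} → d + i ≡ j → Dist G (SQ.at k) (SQ.at l) e → d ≡ e
      lengths-agree {d} d+i≡j = Dist-unique G (SP.segment-Dist d d+i≡j j≤n)
        ∘ subst₂ (λ u v → Dist G u v _) (sym Pi≡Qk) (sym Pj≡Ql)

      compare : k ≤ l ⊎ l ≤ k → Aligned i k j l ⊎ Opposed i k j l
      compare (inj₁ k≤l) =
        let d , d+i≡j = offset i≤j ; e , e+k≡l = offset k≤l in
        inj₁ (Aligned-offset (lengths-agree d+i≡j (SQ.segment-Dist e e+k≡l l≤m)) d+i≡j e+k≡l)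
      compare (inj₂ l≤k) =
        let d , d+i≡j = offset i≤j ; e , e+l≡k = offset l≤k in
        inj₂ (Opposed-offset (lengths-agree d+i≡j (Dist-sym G (SQ.segment-Dist e e+l≡k k≤m))) d+i≡j e+l≡k)

    at-match : ∀ {x y} → P x ≡ Q y → SP.at (toℕ x) ≡ SQ.at (toℕ y)
    at-match {x} {y} Px≡Qy = trans (SP.at-toℕ x) (trans Px≡Qy (sym (SQ.at-toℕ y)))

    aligned-or-opposed : ∀ {i j k l} → P i ≡ Q k → P j ≡ Q l →
      Aligned (toℕ i) (toℕ k) (toℕ j) (toℕ l) ⊎ Opposed (toℕ i) (toℕ k) (toℕ j) (toℕ l)
    aligned-or-opposed {i} {j} {k} {l} Pi≡Qk Pj≡Ql with ≤-total (toℕ i) (toℕ j)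
    ... | inj₁ i≤j = aligned-or-opposed-≤ i≤j (toℕ≤pred[n] j) (toℕ≤pred[n] k) (toℕ≤pred[n] l)
                       (at-match Pi≡Qk) (at-match Pj≡Ql)
    ... | inj₂ j≤i = Sum.map sym sym (aligned-or-opposed-≤ j≤i (toℕ≤pred[n] i) (toℕ≤pred[n] l)
                       (toℕ≤pred[n] k) (at-match Pj≡Ql) (at-match Pi≡Qk))

    parallel : ¬ Reversal → Parallel G P Q
    parallel no-reversal i j k l Pi≡Qk Pj≡Ql i<j with aligned-or-opposed Pi≡Qk Pj≡Ql
    ... | inj₁ aligned = Aligned-< i<j aligned
    ... | inj₂ opposed =
      contradiction (i , j , k , l , Pi≡Qk , Pj≡Ql , i<j , Opposed-< i<j opposed) no-reversal

    antiparallel : Reversal → Antiparallel G P Q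
    antiparallel (a , b , fa , fb , Pa≡Qfa , Pb≡Qfb , a<b , fb<fa) =
      (a , b , a<b , (fa , sym Pa≡Qfa) , (fb , sym Pb≡Qfb)) , reversed
      where
      opposed-ab : Opposed (toℕ a) (toℕ fa) (toℕ b) (toℕ fb)
      opposed-ab with aligned-or-opposed Pa≡Qfa Pb≡Qfb
      ... | inj₁ aligned = contradiction (Aligned-< a<b aligned) (<-asym fb<fa)
      ... | inj₂ opposed = opposed

      opposed-a : ∀ {c fc} → P c ≡ Q fc → Opposed (toℕ a) (toℕ fa) (toℕ c) (toℕ fc)
      opposed-a {c} {fc} Pc≡Qfc with aligned-or-opposed Pa≡Qfa Pc≡Qfc | aligned-or-opposed Pb≡Qfb Pc≡Qfc
      ... | inj₂ opposed-ac | _               = opposed-ac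
      ... | inj₁ _          | inj₂ opposed-bc = trans opposed-ab opposed-bc
      ... | inj₁ aligned-ac | inj₁ aligned-bc =
        contradiction (Aligned-< a<b aligned-ab) (<-asym fb<fa)
        where
        aligned-ab : Aligned (toℕ a) (toℕ fa) (toℕ b) (toℕ fb)
        aligned-ab = Aligned-via {toℕ a} {toℕ fa} {toℕ b} {toℕ fb} {toℕ c} {toℕ fc}
          aligned-ac aligned-bc

      reversed : ∀ i j k l → P i ≡ Q k → P j ≡ Q l → toℕ i < toℕ j → toℕ l < toℕ k
      reversed i j k l Pi≡Qk Pj≡Ql i<j =
        Opposed-< i<j (trans (sym (opposed-a Pi≡Qk)) (opposed-a Pj≡Ql))

mainTheorem2 : (G : Graph) (n m : ℕ) (P : Path G n) (Q : Path G m) →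
    IsShortestPath G n P → IsShortestPath G m Q → Intersect G P Q →
    Parallel G P Q ⊎ Antiparallel G P Q
mainTheorem2 G n m P Q sp sq _ with reversal? G P Q
... | yes reversal   = inj₂ (antiparallel G P Q sp sq reversal)
... | no no-reversal = inj₁ (parallel G P Q sp sq no-reversal)
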